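{- The preorder of ordinary Weihrauch predicates $U\subseteq\mathbb A\times\mathbb A$ under ordinary Weihrauch reducibility $\le_w$ is equivalent (as a preorder) to the preorder of $\neg\neg$-dense modest extended Weihrauch predicates under extended Weihrauch reducibility $\le_W$.
   Context: A partial combinatory algebra (pca) is a set $\mathbb A$ with a partial binary operation $(a,b)\mapsto a\cdot b$ (associating to the left) such that there are $\mathsf K,\mathsf S\in\mathbb A$ with $\mathsf K\cdot a$ defined, $\mathsf K\cdot a\cdot b=a$, $\mathsf S\cdot a\cdot b$ defined and $\mathsf S\cdot a\cdot b\cdot c=(a\cdot c)\cdot(b\cdot c)$. An elementary sub-pca is a subset $\mathbb A'\subseteq\mathbb A$ closed under application and containing some such $\mathsf K,\mathsf S$. Fix a pca $\mathbb A$ and elementary sub-pca $\mathbb A'$. An extended Weihrauch predicate is a map $f:\mathbb A\to\mathcal P(\mathcal P(\mathbb A))$ with support $\mathrm{supp}(f)=\{r\mid f(r)\neq\emptyset\}$; it is modest if each $f(r)$ has at most one element, and $\neg\neg$-dense if $\theta\neq\emptyset$ for all $r$ and all $\theta\in f(r)$. $f\le_W g$ holds when there exist $\ell_1,\ell_2\in\mathbb A'$ such that for all $r\in\mathrm{supp}(f)$: (1) $\ell_1\cdot r$ is defined and lies in $\mathrm{supp}(g)$; (2) for every $\theta\in f(r)$ there is $\xi\in g(\ell_1\cdot r)$ such that for every $s\in\xi$, $\ell_2\cdot r\cdot s$ is defined and belongs to $\theta$. An ordinary Weihrauch predicate is a relation $U\subseteq\mathbb A\times\mathbb A$, with support $\mathrm{supp}(U)=\{r\mid\exists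 s.(r,s)\in U\}$ and $U[r]=\{s\mid(r,s)\in U\}$. $U\le_w V$ holds when there exist $\ell_1,\ell_2\in\mathbb A'$ such that for all $r\in\mathrm{supp}(U)$: $\ell_1\cdot r$ is defined and in $\mathrm{supp}(V)$, and for all $s\in V[\ell_1\cdot r]$, $\ell_2\cdot r\cdot s$ is defined and belongs to $U[r]$. Equivalence of preorders means monotone maps in both directions whose composites are equivalent to the identities up to mutual reducibility. -}

module Defs where

open import Level using (Level; _⊔_) renaming (suc to lsuc)
open import Data.Product using (Σ; Σ-syntax; ∃; _×_; _,_)
open import Function.Bundles using (_⇔_)
open import Relation.Binary.PropositionalEquality using (_≡_)

-- Partial applicative structures: application is a functional relation
-- a · b ⇓ c  means "a · b is defined and equals c".

record PAS : Set₁ where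
  field
    Carrier    : Set
    _·_⇓_      : Carrier → Carrier → Carrier → Set
    functional : ∀ {a b x y} → a · b ⇓ x → a · b ⇓ y → x ≡ y

module PASNotation (P : PAS) where
  open PAS P public

  _·_∈_ : Carrier → Carrier → (Carrier → Set) → Set
  a · b ∈ Q = Σ[ x ∈ Carrier ] ((a · b ⇓ x) × Q x)

  _·_·_∈_ : Carrier → Carrier → Carrier → (Carrier → Set) → Set
  a · b · c ∈ Q = Σ[ x ∈ Carrier ] ((a · b ⇓ x) × (x · c ∈ Q))

  _·_·_⇓_ : Carrier → Carrier → Carrier → Carrier → Set
  a · b · c ⇓ z = a · b · c ∈ (λ w → w ≡ z)

  _·_·_·_⇓_ : Carrier → Carrier → Carrier → Carrier → Carrier → Set
  a · b · c · d ⇓ z = Σ[ x ∈ Carrier ] ((a · b · c ⇓ x) × (x · d ⇓ z))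

  record IsKS (K S : Carrier) : Set where
    field
      K-def  : ∀ a → Σ[ x ∈ Carrier ] (K · a ⇓ x)
      K-law  : ∀ a b → K · a · b ⇓ a
      S-def  : ∀ a b → Σ[ x ∈ Carrier ] (S · a · b ⇓ x)
      S-law  : ∀ a b c z →
               (S · a · b · c ⇓ z) ⇔
               (Σ[ u ∈ Carrier ] Σ[ v ∈ Carrier ]
                  ((a · c ⇓ u) × (b · c ⇓ v) × (u · v ⇓ z)))

record PCA : Set₁ where
  field
    pas : PAS
  open PASNotation pas
  field
    K S  : Carrier
    isKS : IsKS K S

record ElemSubPCA (𝔸 : PCA) : Set₁ where
  open PCA 𝔸 using (pas)
  open PASNotation pas
  field
    Sub     : Carrier → Set
    closed  : ∀ {a b c} → Sub a → Sub b → a · b ⇓ c → Sub c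
    K' S'   : Carrier
    K'∈     : Sub K'
    S'∈     : Sub S'
    isKS'   : IsKS K' S'

record PreorderEquiv {a b ℓ₁ ℓ₂ : Level} {X : Set a} {Y : Set b}
         (_≤X_ : X → X → Set ℓ₁) (_≤Y_ : Y → Y → Set ℓ₂)
         : Set (a ⊔ b ⊔ ℓ₁ ⊔ ℓ₂) where
  field
    F      : X → Y
    G      : Y → X
    F-mono : ∀ {x x'} → x ≤X x' → F x ≤Y F x'
    G-mono : ∀ {y y'} → y ≤Y y' → G y ≤X G y'
    GF≤    : ∀ x → G (F x) ≤X x
    ≤GF    : ∀ x → x ≤X G (F x)
    FG≤    : ∀ y → F (G y) ≤Y y
    ≤FG    : ∀ y → y ≤Y F (G y)

module Weihrauch (𝔸 : PCA) (𝔸' : ElemSubPCA 𝔸) where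
  open PCA 𝔸 using (pas)
  open PASNotation pas
  open ElemSubPCA 𝔸' using (Sub)

  A : Set
  A = Carrier

  OrdPred : Set₁
  OrdPred = A → A → Set

  suppO : OrdPred → A → Set
  suppO U r = Σ[ s ∈ A ] U r s

  _≤w_ : OrdPred → OrdPred → Set
  U ≤w V = Σ[ ℓ₁ ∈ A ] Σ[ ℓ₂ ∈ A ] (Sub ℓ₁ × Sub ℓ₂ ×
    (∀ r → suppO U r →
       Σ[ x ∈ A ] ((ℓ₁ · r ⇓ x) × suppO V x ×
         (∀ s → V x s → (ℓ₂ · r · s ∈ U r)))))

  -- Extended Weihrauch predicates f : A → P(P(A)).
  -- f(r) ⊆ P(A) is represented (predicatively) as a family of subsets
  -- indexed by Idx r; "θ ∈ f(r)" means θ = mem r i for some i : Idx r.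
  record ExtPred : Set₁ where
    field
      Idx : A → Set
      mem : (r : A) → Idx r → A → Set
  open ExtPred public

  suppE : ExtPred → A → Set
  suppE f r = Idx f r

  Modest : ExtPred → Set
  Modest f = ∀ r (i j : Idx f r) (a : A) → mem f r i a ⇔ mem f r j a

  Dense : ExtPred → Set
  Dense f = ∀ r (i : Idx f r) → Σ[ a ∈ A ] mem f r i a

  _≤W_ : ExtPred → ExtPred → Set
  f ≤W g = Σ[ ℓ₁ ∈ A ] Σ[ ℓ₂ ∈ A ] (Sub ℓ₁ × Sub ℓ₂ ×
    (∀ r → suppE f r →
       Σ[ x ∈ A ] ((ℓ₁ · r ⇓ x) × suppE g x ×
         (∀ (i : Idx f r) → Σ[ j ∈ Idx g x ]
            (∀ s → mem g x j s → (ℓ₂ · r · s ∈ mem f r i))))))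

  DMExtPred : Set₁
  DMExtPred = Σ[ f ∈ ExtPred ] (Modest f × Dense f)

  _≤Wdm_ : DMExtPred → DMExtPred → Set
  (f , _) ≤Wdm (g , _) = f ≤W g

module Submission where

open import Defs
open import Data.Product using (Σ; Σ-syntax; _×_; _,_; proj₁; proj₂)
open import Function.Bundles using (Equivalence)
open import Function.Construct.Identity using (⇔-id)
open import Relation.Binary.PropositionalEquality using (_≡_; refl; subst)

-- Both directions are the obvious translations: a relation U becomes the
-- extended predicate with f(r) = {U[r]} on supp U, and an extended predicate
-- becomes the union relation U[r] = ⋃ f(r).  All round trips are reduced by
-- the identity I = S K K forward and the second projection K I backward.
-- Density is what keeps r in the support of the union relation, and
-- modesty lets any element of g(x) answer any request.

module ApplicationChains (P : PAS) where
  open PASNotation P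

  ⇓₂-at : ∀ {a b c x z} → a · b · c ⇓ z → a · b ⇓ x → x · c ⇓ z
  ⇓₂-at (y , ab⇓y , w , yc⇓w , refl) ab⇓x = subst (λ t → t · _ ⇓ w) (functional ab⇓y ab⇓x) yc⇓w

  functional₂ : ∀ {a b c x y} → a · b · c ⇓ x → a · b · c ⇓ y → x ≡ y
  functional₂ (z , ab⇓z , w , zc⇓w , refl) abc⇓y = functional zc⇓w (⇓₂-at abc⇓y ab⇓z)

  ⇓₃-at : ∀ {a b c d x z} → a · b · c · d ⇓ z → a · b · c ⇓ x → x · d ⇓ z
  ⇓₃-at (y , abc⇓y , yd⇓z) abc⇓x = subst (λ t → t · _ ⇓ _) (functional₂ abc⇓y abc⇓x) yd⇓z

module Combinators (P : PAS) {K S : PAS.Carrier P} (isKS : PASNotation.IsKS P K S) where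
  open PASNotation P
  open IsKS isKS
  open ApplicationChains P

  I : Carrier
  I = proj₁ (S-def K K)

  SKK⇓I : S · K · K ⇓ I
  SKK⇓I = proj₂ (S-def K K)

  I-law : ∀ a → I · a ⇓ a
  I-law a = ⇓₃-at SKKa⇓a SKK⇓I
    where
    u = proj₁ (K-def a)
    Ka⇓u = proj₂ (K-def a)
    SKKa⇓a : S · K · K · a ⇓ a
    SKKa⇓a = Equivalence.from (S-law K K a a) (u , u , Ka⇓u , Ka⇓u , ⇓₂-at (K-law a u) Ka⇓u)

  KI : Carrier
  KI = proj₁ (K-def I)

  KI⇓ : K · I ⇓ KI
  KI⇓ = proj₂ (K-def I)

  KI-law : ∀ {Q : Carrier → Set} r s → Q s → KI · r · s ∈ Q
  KI-law r s q = I , ⇓₂-at (K-law I r) KI⇓ , s , I-law s , q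

module SubCombinators (𝔸 : PCA) (𝔸' : ElemSubPCA 𝔸) where
  open PCA 𝔸 using (pas)
  open PASNotation pas
  open ElemSubPCA 𝔸'
  open Combinators pas isKS' public

  closed₂ : ∀ {a b c x} → Sub a → Sub b → Sub c → a · b · c ⇓ x → Sub x
  closed₂ a∈ b∈ c∈ (y , ab⇓y , w , yc⇓w , refl) = closed (closed a∈ b∈ ab⇓y) c∈ yc⇓w

  I∈ : Sub I
  I∈ = closed₂ S'∈ K'∈ K'∈ SKK⇓I

  KI∈ : Sub KI
  KI∈ = closed K'∈ I∈ KI⇓

module WeihrauchEquivalence (𝔸 : PCA) (𝔸' : ElemSubPCA 𝔸) where
  open PCA 𝔸 using (pas)
  open PASNotation pas
  open Weihrauch 𝔸 𝔸'
  open SubCombinators 𝔸 𝔸'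

  ≤w-via-identity : ∀ {U V} →
    (∀ r → suppO U r → suppO V r × (∀ s → V r s → U r s)) → U ≤w V
  ≤w-via-identity h = I , KI , I∈ , KI∈ , λ r r∈U →
    let (r∈V , V⊆U) = h r r∈U in r , I-law r , r∈V , λ s vs → KI-law r s (V⊆U s vs)

  ≤W-via-identity : ∀ {f g} →
    (∀ r → suppE f r →
       suppE g r × (∀ i → Σ[ j ∈ Idx g r ] (∀ s → mem g r j s → mem f r i s))) →
    f ≤W g
  ≤W-via-identity h = I , KI , I∈ , KI∈ , λ r r∈f →
    let (r∈g , refine) = h r r∈f in r , I-law r , r∈g , λ i →
      let (j , g⊆f) = refine i in j , λ s ms → KI-law r s (g⊆f s ms)

  toExt : OrdPred → DMExtPred
  toExt U = record { Idx = suppO U ; mem = λ r _ → U r }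
          , (λ r _ _ s → ⇔-id (U r s))
          , (λ r r∈U → r∈U)

  toOrd : DMExtPred → OrdPred
  toOrd (f , _) r s = Σ[ i ∈ Idx f r ] mem f r i s

  toExt-mono : ∀ {U V} → U ≤w V → toExt U ≤Wdm toExt V
  toExt-mono (ℓ₁ , ℓ₂ , ℓ₁∈ , ℓ₂∈ , h) = ℓ₁ , ℓ₂ , ℓ₁∈ , ℓ₂∈ , λ r r∈U →
    let (x , ℓ₁r⇓x , x∈V , back) = h r r∈U in x , ℓ₁r⇓x , x∈V , λ _ → x∈V , back

  toOrd-mono : ∀ {f g} → f ≤Wdm g → toOrd f ≤w toOrd g
  toOrd-mono {f , _} {g , modest-g , dense-g} (ℓ₁ , ℓ₂ , ℓ₁∈ , ℓ₂∈ , h) =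
    ℓ₁ , ℓ₂ , ℓ₁∈ , ℓ₂∈ , λ { r (_ , i , _) →
      let (x , ℓ₁r⇓x , j₀ , refine) = h r i
          (j , back) = refine i
      in x , ℓ₁r⇓x , (let (s , ms) = dense-g x j₀ in s , j₀ , ms) ,
         λ { s (j' , ms) →
           let (y , ℓ₂r⇓y , z , ys⇓z , mz) = back s (Equivalence.to (modest-g x j' j s) ms)
           in y , ℓ₂r⇓y , z , ys⇓z , i , mz } }

  toOrd-toExt-≤ : ∀ U → toOrd (toExt U) ≤w U
  toOrd-toExt-≤ U = ≤w-via-identity λ { r (_ , r∈U , _) → r∈U , λ s us → r∈U , us }

  ≤-toOrd-toExt : ∀ U → U ≤w toOrd (toExt U)
  ≤-toOrd-toExt U = ≤w-via-identity λ { r (s , us) → (s , (s , us) , us) , λ _ → proj₂ }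

  toExt-toOrd-≤ : ∀ f → toExt (toOrd f) ≤Wdm f
  toExt-toOrd-≤ (f , _) = ≤W-via-identity λ { r (_ , i , _) → i , λ _ → i , λ s ms → i , ms }

  ≤-toExt-toOrd : ∀ f → f ≤Wdm toExt (toOrd f)
  ≤-toExt-toOrd (f , modest , dense) = ≤W-via-identity λ r i →
    (let (s , ms) = dense r i in s , i , ms) ,
    λ i' → (let (s , ms) = dense r i in s , i , ms) ,
           λ { s (j , ms) → Equivalence.to (modest r j i' s) ms }

proposition3p9 : (𝔸 : PCA) (𝔸' : ElemSubPCA 𝔸) →
    PreorderEquiv (Weihrauch._≤w_ 𝔸 𝔸') (Weihrauch._≤Wdm_ 𝔸 𝔸')
proposition3p9 𝔸 𝔸' = record
  { F      = toExt
  ; G      = toOrd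
  ; F-mono = toExt-mono
  ; G-mono = λ {f} {g} → toOrd-mono {f} {g}
  ; GF≤    = toOrd-toExt-≤
  ; ≤GF    = ≤-toOrd-toExt
  ; FG≤    = toExt-toOrd-≤
  ; ≤FG    = ≤-toExt-toOrd
  }
  where open WeihrauchEquivalence 𝔸 𝔸'
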